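{- Let $k$ be a positive integer and let $C$ be a path or a cycle with $\ell$ vertices. (1) If $k\in\{9,10\}$ and $\ell\ge5$, then $C$ has a $k$-pp with at least $\frac45\ell$ edges. (2) If $k\ge 11$ and $\ell\ge 6$, then $C$ has a $k$-pp with at least $\frac56\ell$ edges.
   Context: A $k^-$-path partition ($k$-pp) of a graph $H$ is a spanning subgraph of $H$ in which every connected component is a path with at most $k$ vertices. -}

module Defs where

open import Data.Nat using (ℕ; zero; suc; _≤_; _≡ᵇ_; _<ᵇ_)
open import Data.Fin using (Fin; toℕ)
open import Data.Bool using (Bool; true; false; _∧_; _∨_; if_then_else_)
open import Data.List using (List; map; allFin)
open import Data.Nat.ListAction using (sum)
open import Data.Product using (Σ; _×_; ∃)
open import Data.Sum using (_⊎_)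
open import Relation.Binary.PropositionalEquality using (_≡_)
open import Function.Definitions using (Injective)

Graph : ℕ → Set
Graph n = Fin n → Fin n → Bool

pathGraph : (n : ℕ) → Graph n
pathGraph n i j = (suc (toℕ i) ≡ᵇ toℕ j) ∨ (suc (toℕ j) ≡ᵇ toℕ i)

-- The cycle C_n (meant for n ≥ 3): the path plus the edge {0, n-1}.
cycleGraph : (n : ℕ) → Graph n
cycleGraph n i j = pathGraph n i j
  ∨ (((toℕ i ≡ᵇ 0) ∧ (suc (toℕ j) ≡ᵇ n)) ∨ ((toℕ j ≡ᵇ 0) ∧ (suc (toℕ i) ≡ᵇ n)))

data Shape : Set where
  path cycle : Shape

shapeGraph : Shape → (n : ℕ) → Graph n
shapeGraph path  n = pathGraph n
shapeGraph cycle n = cycleGraph n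

Symmetric : ∀ {n} → Graph n → Set
Symmetric {n} H = (i j : Fin n) → H i j ≡ H j i

SpanningSubgraph : ∀ {n} → Graph n → Graph n → Set
SpanningSubgraph {n} H G = (i j : Fin n) → H i j ≡ true → G i j ≡ true

-- The connected component of v in H is a path with at most k vertices:
-- there are distinct vertices p 0, ..., p (m-1) (m ≤ k), one of them v,
-- consecutive ones adjacent in H, and every H-edge leaving any p i goes to
-- a consecutive p j (so the vertex set is closed under adjacency, hence is
-- the whole component, and the component's edges are exactly the path edges).
ComponentIsShortPath : ∀ {n} → ℕ → Graph n → Fin n → Set
ComponentIsShortPath {n} k H v =
  Σ ℕ λ m → Σ (Fin m → Fin n) λ p →
    m ≤ k
    × Injective _≡_ _≡_ p
    × (∃ λ (i : Fin m) → p i ≡ v)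
    × ((i j : Fin m) → suc (toℕ i) ≡ toℕ j → H (p i) (p j) ≡ true)
    × ((i : Fin m) (w : Fin n) → H (p i) w ≡ true →
         ∃ λ (j : Fin m) → p j ≡ w × (suc (toℕ i) ≡ toℕ j ⊎ suc (toℕ j) ≡ toℕ i))

IsKPP : ∀ {n} → ℕ → Graph n → Graph n → Set
IsKPP {n} k G H =
  Symmetric H × SpanningSubgraph H G × ((v : Fin n) → ComponentIsShortPath k H v)

edgeCount : ∀ {n} → Graph n → ℕ
edgeCount {n} H =
  sum (map (λ i → sum (map (λ j → if (toℕ i <ᵇ toℕ j) ∧ H i j then 1 else 0)
                           (allFin n)))
           (allFin n))

-- Cut the vertices 0, …, ℓ − 1 of the path (or cycle) into consecutive blocks of b := c + 1
-- vertices, the last block absorbing the remainder, and keep exactly the path edges inside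
-- blocks. With q := ⌊ℓ / b⌋ blocks, each has fewer than 2b vertices, so it is a path with at
-- most k vertices once 2b ≤ k + 1. The block label of a vertex grows by at most one per step,
-- so of the ℓ − 1 path edges exactly q − 1 are cut, leaving ℓ − q edges; since q b ≤ ℓ this
-- gives c ℓ ≤ b (ℓ − q).
module Submission where

open import Defs
open import Data.Nat using (ℕ; zero; suc; pred; _+_; _*_; _∸_; _⊓_; _≤_; _<_; z≤n; s≤s; z<s; _≡ᵇ_; _<ᵇ_; NonZero; >-nonZero; >-nonZero⁻¹)
open import Data.Nat.Properties
open import Data.Nat.DivMod
  using (_/_; m≡m%n+[m/n]*n; m%n<n; m/n*n≤m; m*n/n≡m; /-monoˡ-≤; m≥n⇒m/n>0; m/n≡1+[m∸n]/n; m<n*o⇒m/o<n)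
open import Data.Fin using (Fin; toℕ; fromℕ<) renaming (zero to fzero; suc to fsuc)
open import Data.Fin.Properties using (toℕ-fromℕ<; toℕ-injective; toℕ<n)
open import Data.Bool using (Bool; true; false; _∧_; _∨_; if_then_else_)
open import Data.Bool.Properties using (∨-comm; ∧-conicalˡ; ∧-conicalʳ; T-≡)
open import Data.List using (map; allFin; tabulate)
open import Data.List.Properties using (map-tabulate)
open import Data.Nat.ListAction using (sum)
open import Data.Product using (∃; _×_; _,_)
open import Data.Sum using (_⊎_; inj₁; inj₂)
open import Data.Empty using (⊥-elim)
open import Function using (_∘_)
open import Function.Bundles using (Equivalence)
open import Function.Definitions using (Injective)
open import Relation.Binary.PropositionalEquality
  using (_≡_; refl; sym; trans; cong; cong₂; subst; module ≡-Reasoning)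
open import Algebra.Properties.CommutativeSemigroup +-commutativeSemigroup using (x∙yz≈y∙xz)

≡ᵇ-true⇒≡ : ∀ m n → (m ≡ᵇ n) ≡ true → m ≡ n
≡ᵇ-true⇒≡ m n e = ≡ᵇ⇒≡ m n (Equivalence.from T-≡ e)

≡⇒≡ᵇ-true : ∀ {m n} → m ≡ n → (m ≡ᵇ n) ≡ true
≡⇒≡ᵇ-true {m} {n} e = Equivalence.to T-≡ (≡⇒≡ᵇ m n e)

≡ᵇ-sym : ∀ m n → (m ≡ᵇ n) ≡ (n ≡ᵇ m)
≡ᵇ-sym zero    zero    = refl
≡ᵇ-sym zero    (suc n) = refl
≡ᵇ-sym (suc m) zero    = refl
≡ᵇ-sym (suc m) (suc n) = ≡ᵇ-sym m n

∨-trueˡ : ∀ {x} y → x ≡ true → x ∨ y ≡ true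
∨-trueˡ y refl = refl

∨-true : ∀ {x y} → x ∨ y ≡ true → x ≡ true ⊎ y ≡ true
∨-true {true}  _ = inj₁ refl
∨-true {false} e = inj₂ e

sumBelow : ℕ → (ℕ → ℕ) → ℕ
sumBelow zero    r = 0
sumBelow (suc n) r = r 0 + sumBelow n (r ∘ suc)

stays : (ℕ → ℕ) → ℕ → ℕ
stays f i = if f i ≡ᵇ f (suc i) then 1 else 0

stays+next : ∀ f i → f i ≤ f (suc i) → f (suc i) ≤ suc (f i) → stays f i + f (suc i) ≡ suc (f i)
stays+next f i up step with f i ≡ᵇ f (suc i) in eq
... | true = cong suc (sym (≡ᵇ-true⇒≡ _ _ eq))
... | false with m≤n⇒m<n∨m≡n up
...   | inj₁ lt = ≤-antisym step lt
...   | inj₂ e with trans (sym (≡⇒≡ᵇ-true e)) eq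
...     | ()

sumBelow-stays : ∀ n f → (∀ i → f i ≤ f (suc i)) → (∀ i → f (suc i) ≤ suc (f i)) →
                 sumBelow n (stays f) + f n ≡ n + f 0
sumBelow-stays zero    f up step = refl
sumBelow-stays (suc n) f up step = begin
  stays f 0 + sumBelow n (stays (f ∘ suc)) + f (suc n)
    ≡⟨ +-assoc (stays f 0) _ _ ⟩
  stays f 0 + (sumBelow n (stays (f ∘ suc)) + f (suc n))
    ≡⟨ cong (stays f 0 +_) (sumBelow-stays n (f ∘ suc) (up ∘ suc) (step ∘ suc)) ⟩
  stays f 0 + (n + f 1)
    ≡⟨ x∙yz≈y∙xz (stays f 0) n (f 1) ⟩
  n + (stays f 0 + f 1)
    ≡⟨ cong (n +_) (stays+next f 0 (up 0) (step 0)) ⟩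
  n + suc (f 0)
    ≡⟨ +-suc n (f 0) ⟩
  suc n + f 0 ∎
  where open ≡-Reasoning

sum-allFin : ∀ {n} (h : Fin n → ℕ) → sum (map h (allFin n)) ≡ sum (tabulate h)
sum-allFin h = cong sum (map-tabulate (λ i → i) h)

lookup≤sum-tabulate : ∀ {n} (h : Fin n → ℕ) j → h j ≤ sum (tabulate h)
lookup≤sum-tabulate h fzero    = m≤m+n (h fzero) _
lookup≤sum-tabulate h (fsuc j) = ≤-trans (lookup≤sum-tabulate (h ∘ fsuc) j) (m≤n+m _ (h fzero))

sumBelow≤sum-tabulate : ∀ n (h : Fin (suc n) → ℕ) r →
                        (∀ i → toℕ i < n → r (toℕ i) ≤ h i) → sumBelow n r ≤ sum (tabulate h)
sumBelow≤sum-tabulate zero    h r r≤h = z≤n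
sumBelow≤sum-tabulate (suc n) h r r≤h =
  +-mono-≤ (r≤h fzero z<s)
           (sumBelow≤sum-tabulate n (h ∘ fsuc) (r ∘ suc) (λ i i<n → r≤h (fsuc i) (s≤s i<n)))

adjacent : ℕ → ℕ → Bool
adjacent m n = (suc m ≡ᵇ n) ∨ (suc n ≡ᵇ m)

blockGraph : ∀ {ℓ} → (ℕ → ℕ) → Graph ℓ
blockGraph σ i j = adjacent (toℕ i) (toℕ j) ∧ (σ (toℕ i) ≡ᵇ σ (toℕ j))

module _ {ℓ : ℕ} (σ : ℕ → ℕ) where

  blockGraph-symmetric : Symmetric (blockGraph {ℓ} σ)
  blockGraph-symmetric i j =
    cong₂ _∧_ (∨-comm (suc (toℕ i) ≡ᵇ toℕ j) _) (≡ᵇ-sym (σ (toℕ i)) _)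

  blockGraph-spanning : ∀ s → SpanningSubgraph (blockGraph {ℓ} σ) (shapeGraph s ℓ)
  blockGraph-spanning path  i j e = ∧-conicalˡ (adjacent (toℕ i) (toℕ j)) _ e
  blockGraph-spanning cycle i j e = ∨-trueˡ _ (∧-conicalˡ (adjacent (toℕ i) (toℕ j)) _ e)

module Interval {ℓ a m : ℕ} (a+m≤ℓ : a + m ≤ ℓ) where

  shift : Fin m → Fin ℓ
  shift x = fromℕ< (<-≤-trans (+-monoʳ-< a (toℕ<n x)) a+m≤ℓ)

  toℕ-shift : ∀ x → toℕ (shift x) ≡ a + toℕ x
  toℕ-shift x = toℕ-fromℕ< _

  shift-injective : Injective _≡_ _≡_ shift
  shift-injective {x} {y} e =
    toℕ-injective (+-cancelˡ-≡ a _ _ (trans (sym (toℕ-shift x)) (trans (cong toℕ e) (toℕ-shift y))))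

  shift-onto : ∀ (w : Fin ℓ) → a ≤ toℕ w → toℕ w < a + m → ∃ λ j → shift j ≡ w
  shift-onto w a≤w w<a+m = fromℕ< j<m , toℕ-injective (begin
    toℕ (shift (fromℕ< j<m)) ≡⟨ toℕ-shift _ ⟩
    a + toℕ (fromℕ< j<m)     ≡⟨ cong (a +_) (toℕ-fromℕ< j<m) ⟩
    a + (toℕ w ∸ a)          ≡⟨ m+[n∸m]≡n a≤w ⟩
    toℕ w                    ∎)
    where
    open ≡-Reasoning
    j<m : toℕ w ∸ a < m
    j<m = +-cancelˡ-< a _ _ (subst (_< a + m) (sym (m+[n∸m]≡n a≤w)) w<a+m)

  shift-succ : ∀ i j → (suc (toℕ (shift i)) ≡ᵇ toℕ (shift j)) ≡ true → suc (toℕ i) ≡ toℕ j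
  shift-succ i j e = +-cancelˡ-≡ a _ _ (begin
    a + suc (toℕ i)      ≡⟨ +-suc a (toℕ i) ⟩
    suc (a + toℕ i)      ≡⟨ cong suc (toℕ-shift i) ⟨
    suc (toℕ (shift i))  ≡⟨ ≡ᵇ-true⇒≡ _ _ e ⟩
    toℕ (shift j)        ≡⟨ toℕ-shift j ⟩
    a + toℕ j            ∎)
    where open ≡-Reasoning

  shift-adjacent : ∀ i j → adjacent (toℕ (shift i)) (toℕ (shift j)) ≡ true →
                   suc (toℕ i) ≡ toℕ j ⊎ suc (toℕ j) ≡ toℕ i
  shift-adjacent i j e with ∨-true e
  ... | inj₁ i→j = inj₁ (shift-succ i j i→j)
  ... | inj₂ j→i = inj₂ (shift-succ j i j→i)

blockGraph-component : ∀ {ℓ} σ k (v : Fin ℓ) a m → a + m ≤ ℓ → m ≤ k →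
                       (∀ y → y < m → σ (a + y) ≡ σ (toℕ v)) →
                       (∀ (w : Fin ℓ) → σ (toℕ w) ≡ σ (toℕ v) → a ≤ toℕ w × toℕ w < a + m) →
                       ComponentIsShortPath k (blockGraph σ) v
blockGraph-component σ k v a m a+m≤ℓ m≤k inside outside =
  m , shift , m≤k , shift-injective , v∈ , consecutive , closed
  where
  open Interval {a = a} {m} a+m≤ℓ

  σ-shift : ∀ i → σ (toℕ (shift i)) ≡ σ (toℕ v)
  σ-shift i = trans (cong σ (toℕ-shift i)) (inside (toℕ i) (toℕ<n i))

  v∈ : ∃ λ i → shift i ≡ v
  v∈ = let a≤v , v<a+m = outside v refl in shift-onto v a≤v v<a+m

  consecutive : ∀ i j → suc (toℕ i) ≡ toℕ j → blockGraph σ (shift i) (shift j) ≡ true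
  consecutive i j i→j = cong₂ _∧_
    (∨-trueˡ _ (≡⇒≡ᵇ-true (begin
      suc (toℕ (shift i)) ≡⟨ cong suc (toℕ-shift i) ⟩
      suc (a + toℕ i)     ≡⟨ +-suc a (toℕ i) ⟨
      a + suc (toℕ i)     ≡⟨ cong (a +_) i→j ⟩
      a + toℕ j           ≡⟨ toℕ-shift j ⟨
      toℕ (shift j)       ∎)))
    (≡⇒≡ᵇ-true (trans (σ-shift i) (sym (σ-shift j))))
    where open ≡-Reasoning

  closed : ∀ i w → blockGraph σ (shift i) w ≡ true →
           ∃ λ j → shift j ≡ w × (suc (toℕ i) ≡ toℕ j ⊎ suc (toℕ j) ≡ toℕ i)
  closed i w e with outside w (trans (sym (≡ᵇ-true⇒≡ _ _ (∧-conicalʳ _ _ e))) (σ-shift i))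
  ... | a≤w , w<a+m with shift-onto w a≤w w<a+m
  ...   | j , refl = j , refl , shift-adjacent i j (∧-conicalˡ _ _ e)

blockGraph-edgeCount : ∀ n σ → sumBelow n (stays σ) ≤ edgeCount (blockGraph {suc n} σ)
blockGraph-edgeCount n σ =
  subst (sumBelow n (stays σ) ≤_) (sym (sum-allFin row)) (sumBelow≤sum-tabulate n row (stays σ) stays≤row)
  where
  forward : Fin (suc n) → Fin (suc n) → ℕ
  forward i j = if (toℕ i <ᵇ toℕ j) ∧ blockGraph σ i j then 1 else 0

  row : Fin (suc n) → ℕ
  row i = sum (map (forward i) (allFin (suc n)))

  stays≤row : ∀ i → toℕ i < n → stays σ (toℕ i) ≤ row i
  stays≤row i i<n with σ (toℕ i) ≡ᵇ σ (suc (toℕ i)) in eq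
  ... | false = z≤n
  ... | true  = subst (_≤ row i) forward-edge
                  (subst (forward i i+1 ≤_) (sym (sum-allFin (forward i))) (lookup≤sum-tabulate (forward i) i+1))
    where
    i+1 : Fin (suc n)
    i+1 = fromℕ< (s≤s i<n)
    toℕ-i+1 : toℕ i+1 ≡ suc (toℕ i)
    toℕ-i+1 = toℕ-fromℕ< (s≤s i<n)
    forward-edge : forward i i+1 ≡ 1
    forward-edge = cong (λ b → if b then 1 else 0) (cong₂ _∧_
      (trans (cong (toℕ i <ᵇ_) toℕ-i+1) (Equivalence.to T-≡ (<⇒<ᵇ (n<1+n (toℕ i)))))
      (cong₂ _∧_ (∨-trueˡ _ (≡⇒≡ᵇ-true (sym toℕ-i+1)))
                 (≡⇒≡ᵇ-true (trans (≡ᵇ-true⇒≡ (σ (toℕ i)) _ eq) (cong σ (sym toℕ-i+1))))))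

c*ℓ≤[1+c]*E : ∀ c ℓ E q → q * suc c ≤ ℓ → ℓ ≤ E + q → c * ℓ ≤ suc c * E
c*ℓ≤[1+c]*E c ℓ E q qb≤ℓ ℓ≤E+q = +-cancelˡ-≤ ℓ (c * ℓ) (suc c * E) (begin
  suc c * ℓ              ≤⟨ *-monoʳ-≤ (suc c) ℓ≤E+q ⟩
  suc c * (E + q)        ≡⟨ *-distribˡ-+ (suc c) E q ⟩
  suc c * E + suc c * q  ≤⟨ +-monoʳ-≤ (suc c * E) (subst (_≤ ℓ) (*-comm q (suc c)) qb≤ℓ) ⟩
  suc c * E + ℓ          ≡⟨ +-comm (suc c * E) ℓ ⟩
  ℓ + suc c * E          ∎)
  where open ≤-Reasoning

module _ {b : ℕ} .{{_ : NonZero b}} where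

  m<[1+m/n]*n : ∀ m → m < suc (m / b) * b
  m<[1+m/n]*n m = subst (_< b + (m / b) * b) (sym (m≡m%n+[m/n]*n m b)) (+-monoˡ-< ((m / b) * b) (m%n<n m b))

  m*n≤o⇒m≤o/n : ∀ m o → m * b ≤ o → m ≤ o / b
  m*n≤o⇒m≤o/n m o le = subst (_≤ o / b) (m*n/n≡m m b) (/-monoˡ-≤ b le)

  o/n≡m : ∀ m o → m * b ≤ o → o < suc m * b → o / b ≡ m
  o/n≡m m o lo hi = ≤-antisym (≤-pred (m<n*o⇒m/o<n {o} {suc m} {b} hi)) (m*n≤o⇒m≤o/n m o lo)

  [1+m]/n≤1+m/n : ∀ m → suc m / b ≤ suc (m / b)
  [1+m]/n≤1+m/n m = begin
    suc m / b            ≤⟨ /-monoˡ-≤ b (m<n+m m (>-nonZero⁻¹ b)) ⟩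
    (b + m) / b          ≡⟨ m/n≡1+[m∸n]/n (m≤m+n b m) ⟩
    suc ((b + m ∸ b) / b) ≡⟨ cong (λ x → suc (x / b)) (m+n∸m≡n b m) ⟩
    suc (m / b)          ∎
    where open ≤-Reasoning

module Blocks (c n : ℕ) (c≤n : c ≤ n) where

  b t : ℕ
  b = suc c
  t = pred (suc n / b)

  -- Clamping at t merges the remainder of ℓ = n + 1 modulo b into the last block [t b, n].
  σ : ℕ → ℕ
  σ m = m / b ⊓ t

  1+t≡ℓ/b : suc t ≡ suc n / b
  1+t≡ℓ/b = suc-pred (suc n / b) {{>-nonZero (m≥n⇒m/n>0 (s≤s c≤n))}}

  [1+t]*b≤ℓ : suc t * b ≤ suc n
  [1+t]*b≤ℓ = subst (λ x → x * b ≤ suc n) (sym 1+t≡ℓ/b) (m/n*n≤m (suc n) b)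

  t*b≤n : t * b ≤ n
  t*b≤n = ≤-pred (≤-trans (s≤s (m≤n+m (t * b) c)) [1+t]*b≤ℓ)

  ℓ<t*b+2b : suc n < t * b + (b + b)
  ℓ<t*b+2b = subst (suc n <_) (trans (sym (+-assoc b b (t * b))) (+-comm (b + b) (t * b)))
               (subst (λ x → suc n < suc x * b) (sym 1+t≡ℓ/b) (m<[1+m/n]*n {b} (suc n)))

  σ-mono : ∀ m → σ m ≤ σ (suc m)
  σ-mono m = ⊓-monoˡ-≤ t (/-monoˡ-≤ b (n≤1+n m))

  σ-step : ∀ m → σ (suc m) ≤ suc (σ m)
  σ-step m = ⊓-mono-≤ ([1+m]/n≤1+m/n {b} m) (n≤1+n t)

  σ-last : σ n ≡ t
  σ-last = m≥n⇒m⊓n≡n (m*n≤o⇒m≤o/n {b} t n t*b≤n)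

  σ-inner : ∀ {s y} → s < t → y < b → σ (s * b + y) ≡ s
  σ-inner {s} {y} s<t y<b =
    trans (cong (_⊓ t) (o/n≡m {b} s (s * b + y) (m≤m+n (s * b) y)
                          (subst (s * b + y <_) (+-comm (s * b) b) (+-monoʳ-< (s * b) y<b))))
          (m≤n⇒m⊓n≡m (<⇒≤ s<t))

  σ≡inner⇒ : ∀ {s w} → s < t → σ w ≡ s → s * b ≤ w × w < s * b + b
  σ≡inner⇒ {s} {w} s<t σw≡s =
    subst (_≤ w) (cong (_* b) w/b≡s) (m/n*n≤m w b) ,
    subst (w <_) (trans (cong (λ x → suc x * b) w/b≡s) (+-comm b (s * b))) (m<[1+m/n]*n {b} w)
    where
    w/b≡s : w / b ≡ s
    w/b≡s with ≤-total (w / b) t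
    ... | inj₁ w/b≤t = trans (sym (m≤n⇒m⊓n≡m w/b≤t)) σw≡s
    ... | inj₂ t≤w/b = ⊥-elim (<-irrefl (trans (sym σw≡s) (m≥n⇒m⊓n≡n t≤w/b)) s<t)

  σ-final : ∀ y → σ (t * b + y) ≡ t
  σ-final y = m≥n⇒m⊓n≡n (m*n≤o⇒m≤o/n {b} t (t * b + y) (m≤m+n (t * b) y))

  σ≡t⇒ : ∀ {w} → σ w ≡ t → t * b ≤ w
  σ≡t⇒ {w} σw≡t = ≤-trans (*-monoˡ-≤ b (subst (_≤ w / b) σw≡t (m⊓n≤m (w / b) t))) (m/n*n≤m w b)

  module _ (k : ℕ) (2b≤1+k : b + b ≤ suc k) where

    b≤k : b ≤ k
    b≤k = ≤-pred (≤-trans (s≤s (m≤n+m b c)) 2b≤1+k)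

    final-block-size : suc n ∸ t * b ≤ k
    final-block-size = ≤-pred (≤-trans (m<n+o⇒m∸n<o (suc n) (t * b) ℓ<t*b+2b) 2b≤1+k)

    t*b+[ℓ∸t*b]≡ℓ : t * b + (suc n ∸ t * b) ≡ suc n
    t*b+[ℓ∸t*b]≡ℓ = m+[n∸m]≡n (m≤n⇒m≤1+n t*b≤n)

    component : ∀ v → ComponentIsShortPath k (blockGraph σ) v
    component v with m≤n⇒m<n∨m≡n (m⊓n≤n (toℕ v / b) t)
    ... | inj₁ s<t = blockGraph-component σ k v (σ (toℕ v) * b) b
                       (m≤n⇒m≤1+n (≤-trans (subst (_≤ t * b) (+-comm b _) (*-monoˡ-≤ b s<t)) t*b≤n))
                       b≤k (λ _ y<b → σ-inner s<t y<b) (λ _ e → σ≡inner⇒ s<t e)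
    ... | inj₂ s≡t = blockGraph-component σ k v (t * b) (suc n ∸ t * b)
                       (≤-reflexive t*b+[ℓ∸t*b]≡ℓ) final-block-size
                       (λ y _ → trans (σ-final y) (sym s≡t))
                       (λ w e → σ≡t⇒ (trans e s≡t) , subst (toℕ w <_) (sym t*b+[ℓ∸t*b]≡ℓ) (toℕ<n w))

  edge-bound : c * suc n ≤ b * edgeCount (blockGraph {suc n} σ)
  edge-bound = c*ℓ≤[1+c]*E c (suc n) E (suc n / b) (m/n*n≤m (suc n) b)
                 (subst (suc n ≤_) (trans (sym (+-suc E t)) (cong (E +_) 1+t≡ℓ/b)) (s≤s n≤E+t))
    where
    E : ℕ
    E = edgeCount (blockGraph {suc n} σ)
    n≤E+t : n ≤ E + t
    n≤E+t = subst (_≤ E + t)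
              (trans (cong (sumBelow n (stays σ) +_) (sym σ-last))
                     (trans (sumBelow-stays n σ σ-mono σ-step) (+-identityʳ n)))
              (+-monoˡ-≤ t (blockGraph-edgeCount n σ))

kpp-of-blocks : ∀ c k ℓ s → suc c ≤ ℓ → suc c + suc c ≤ suc k →
                ∃ λ (H : Graph ℓ) → IsKPP k (shapeGraph s ℓ) H × c * ℓ ≤ suc c * edgeCount H
kpp-of-blocks c k (suc n) s (s≤s c≤n) 2b≤1+k =
  blockGraph σ , (blockGraph-symmetric σ , blockGraph-spanning σ s , component k 2b≤1+k) , edge-bound
  where open Blocks c n c≤n

lemma3 : ((k ℓ : ℕ) (s : Shape) → (k ≡ 9 ⊎ k ≡ 10) → 5 ≤ ℓ →
           ∃ λ (H : Graph ℓ) → IsKPP k (shapeGraph s ℓ) H × 4 * ℓ ≤ 5 * edgeCount H)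
         × ((k ℓ : ℕ) (s : Shape) → 11 ≤ k → 6 ≤ ℓ →
           ∃ λ (H : Graph ℓ) → IsKPP k (shapeGraph s ℓ) H × 5 * ℓ ≤ 6 * edgeCount H)
lemma3 = (λ { _ ℓ s (inj₁ refl) 5≤ℓ → kpp-of-blocks 4 9 ℓ s 5≤ℓ ≤-refl
            ; _ ℓ s (inj₂ refl) 5≤ℓ → kpp-of-blocks 4 10 ℓ s 5≤ℓ (n≤1+n 10) })
       , λ k ℓ s 11≤k 6≤ℓ → kpp-of-blocks 5 k ℓ s 6≤ℓ (s≤s 11≤k)
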